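{- Let $r$ be a positive integer, let $H$ be a graph of girth at least $2r+3$ which is not a tree, and let $G=H^r$. For $v\in V(H)$ let $B_v=N_G(v)\cup\{v\}$. Let $u$ be a non-core vertex of $H$. If $B_u\cap V(\mathrm{core}(H))=\emptyset$, then $\mathrm{depth}(u)>r$. Otherwise, the subgraph of $H$ induced by $B_u\cap V(\mathrm{core}(H))$ is a tree whose unique center is $\mathrm{link}(u)$ and in which every leaf is at distance exactly $r-\mathrm{depth}(u)$ from $\mathrm{link}(u)$.
   Context: All graphs are simple, undirected and connected. $H^r$ is the graph on $V(H)$ in which two distinct vertices are adjacent iff their distance in $H$ is at most $r$. For a graph $H$ that is not a tree, $\mathrm{core}(H)$ is the largest subgraph of $H$ with no vertices of degree one (obtained by repeatedly deleting degree-one vertices until none remain). Vertices of $\mathrm{core}(H)$ are core vertices, others are non-core. For a non-core vertex $u$, $\mathrm{link}(u)$ is its closest core vertex and $\mathrm{depth}(u)$ is the distance in $H$ from $u$ to $\mathrm{link}(u)$. -}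

module Defs where

open import Data.Nat using (ℕ; zero; suc; _≤_; _<_; _≡ᵇ_; _+_)
open import Data.Bool using (Bool; true; false; _∧_; not; if_then_else_)
open import Data.Fin using (Fin; inject₁; fromℕ) renaming (zero to fzero; suc to fsuc)
open import Data.List using (List; map; allFin)
open import Data.Nat.ListAction using (sum)
open import Data.Product using (Σ; _×_; _,_; ∃; ∃-syntax)
open import Data.Unit using (⊤)
open import Data.Empty using (⊥)
open import Relation.Nullary using (¬_)
open import Relation.Binary.PropositionalEquality using (_≡_; _≢_)
open import Data.Sum using (_⊎_)
open import Function.Definitions using (Injective)

record Graph (n : ℕ) : Set where
  field
    adj    : Fin n → Fin n → Bool
    sym    : ∀ u v → adj u v ≡ adj v u
    irrefl : ∀ v → adj v v ≡ false
open Graph public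

Adj : ∀ {n} → Graph n → Fin n → Fin n → Set
Adj G u v = adj G u v ≡ true

-- A vertex predicate (vertex set of an induced subgraph of G)
VSet : ℕ → Set₁
VSet n = Fin n → Set

All : ∀ {n} → VSet n
All _ = ⊤

data WalkIn {n} (G : Graph n) (P : VSet n) : Fin n → Fin n → ℕ → Set where
  nil  : ∀ {u} → P u → WalkIn G P u u 0
  cons : ∀ {u w v k} → P u → Adj G u w → WalkIn G P w v k → WalkIn G P u v (suc k)

DistIn : ∀ {n} → Graph n → VSet n → Fin n → Fin n → ℕ → Set
DistIn G P u v d = WalkIn G P u v d × (∀ k → WalkIn G P u v k → d ≤ k)

Dist : ∀ {n} → Graph n → Fin n → Fin n → ℕ → Set
Dist G = DistIn G All

ConnectedIn : ∀ {n} → Graph n → VSet n → Set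
ConnectedIn G P = ∀ u v → P u → P v → ∃[ k ] WalkIn G P u v k

Connected : ∀ {n} → Graph n → Set
Connected G = ConnectedIn G All

-- A cycle of length (suc k) ≥ 3 in G[P]: distinct vertices f 0, …, f k,
-- consecutive ones adjacent, and f k adjacent to f 0.
record CycleIn {n} (G : Graph n) (P : VSet n) (k : ℕ) : Set where
  field
    len≥3  : 2 ≤ k
    vert   : Fin (suc k) → Fin n
    inj    : Injective _≡_ _≡_ vert
    inP    : ∀ i → P (vert i)
    step   : ∀ (i : Fin k) → Adj G (vert (inject₁ i)) (vert (fsuc i))
    close  : Adj G (vert (fromℕ k)) (vert fzero)

AcyclicIn : ∀ {n} → Graph n → VSet n → Set
AcyclicIn G P = ∀ k → ¬ CycleIn G P k

IsTreeIn : ∀ {n} → Graph n → VSet n → Set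
IsTreeIn G P = (∃[ v ] P v) × ConnectedIn G P × AcyclicIn G P

IsTree : ∀ {n} → Graph n → Set
IsTree G = IsTreeIn G All

GirthAtLeast : ∀ {n} → Graph n → ℕ → Set
GirthAtLeast G g = ∀ k → CycleIn G All k → g ≤ suc k

EccIn : ∀ {n} → Graph n → VSet n → Fin n → ℕ → Set
EccIn G P v e =
  (∀ w → P w → ∃[ d ] (d ≤ e × DistIn G P v w d)) ×
  (∃[ w ] (P w × DistIn G P v w e))

IsCenterIn : ∀ {n} → Graph n → VSet n → Fin n → Set
IsCenterIn G P v =
  P v × ∃[ e ] (EccIn G P v e × (∀ w e' → P w → EccIn G P w e' → e ≤ e'))

UniqueCenterIn : ∀ {n} → Graph n → VSet n → Fin n → Set
UniqueCenterIn G P c = IsCenterIn G P c × (∀ v → IsCenterIn G P v → v ≡ c)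

IsLeafIn : ∀ {n} → Graph n → VSet n → Fin n → Set
IsLeafIn G P v =
  P v × (∃[ w ] (P w × Adj G v w)) ×
  (∀ w w' → P w → P w' → Adj G v w → Adj G v w' → w ≡ w')

PowAdj : ∀ {n} → Graph n → ℕ → Fin n → Fin n → Set
PowAdj H r u v = u ≢ v × ∃[ d ] (d ≤ r × Dist H u v d)

InB : ∀ {n} → Graph n → ℕ → Fin n → Fin n → Set
InB H r v w = w ≡ v ⊎ PowAdj H r v w

degIn : ∀ {n} → Graph n → (Fin n → Bool) → Fin n → ℕ
degIn {n} G S v = sum (map (λ w → if S w ∧ adj G v w then 1 else 0) (allFin n))

pruneStep : ∀ {n} → Graph n → (Fin n → Bool) → (Fin n → Bool)
pruneStep G S v = S v ∧ not (degIn G S v ≡ᵇ 1)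

iterate : ∀ {A : Set} → ℕ → (A → A) → A → A
iterate zero    f x = x
iterate (suc k) f x = f (iterate k f x)

-- After n rounds of simultaneous deletion the process has stabilised
coreSet : ∀ {n} → Graph n → Fin n → Bool
coreSet {n} G = iterate n (pruneStep G) (λ _ → true)

IsCore : ∀ {n} → Graph n → Fin n → Set
IsCore G v = coreSet G v ≡ true

IsLink : ∀ {n} → Graph n → Fin n → Fin n → Set
IsLink H u c =
  IsCore H c × (∀ c' d d' → IsCore H c' → Dist H u c d → Dist H u c' d' → d ≤ d')

module Submission where

-- A shortest walk from u to any core vertex w passes through c: pruning removes the
-- non-core vertices of such a walk starting from the u-end, so two shortest walks out of u agree
-- until they reach the core.  Hence B_u ∩ core is exactly the set of core vertices within
-- distance ρ = r ∸ d of c, which is empty precisely when d > r.  Up to level r around c the girth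
-- forbids edges inside a level and second parents, so geodesics from c are unique.  Therefore the
-- ball is a tree in which the geodesics from c are the tree paths; a ball vertex below level ρ
-- keeps a second core neighbour, so the leaves lie at level ρ; and since c has two core branches
-- that both reach level ρ, c has eccentricity ρ while every other vertex has eccentricity > ρ.

open import Defs
open import Data.Nat using (ℕ; zero; suc; _≤_; _<_; _+_; _*_; _∸_; _≟_; _≤?_; _≡ᵇ_; z≤n; s≤s; s≤s⁻¹)
open import Data.Nat.Properties
open import Data.Bool using (Bool; true; false; _∧_; not; if_then_else_) renaming (_≟_ to _≟ᵇ_)
open import Data.Fin using (Fin; toℕ; inject₁; fromℕ) renaming (zero to fzero; suc to fsuc)
import Data.Fin.Properties as FinP
open import Data.Bool.Properties using (¬-not)
open import Data.Fin.Relation.Unary.Top using (View; ‵fromℕ; ‵inj₁; view)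
open import Data.List using (tabulate; allFin)
open import Data.List.Properties using (map-tabulate; map-cong)
open import Data.Nat.ListAction using (sum)
open import Data.Product using (Σ; _×_; _,_; proj₁; proj₂; ∃-syntax)
open import Data.Sum using (_⊎_; inj₁; inj₂)
open import Data.Empty using (⊥-elim)
open import Data.Unit using (tt)
open import Function using (_∘_)
open import Function.Definitions using (Injective)
open import Relation.Nullary using (¬_; Dec; yes; no; contradiction)
open import Relation.Nullary.Decidable using (_×-dec_)
open import Relation.Binary.Definitions using (tri<; tri≈; tri>)
open import Relation.Binary.PropositionalEquality as ≡
  using (_≡_; _≢_; refl; cong; cong₂; subst; subst₂; trans)

least : ∀ (P : ℕ → Set) → (∀ i → Dec (P i)) → ∀ {N} → P N →
        Σ ℕ λ j → j ≤ N × P j × (∀ i → i < j → ¬ P i)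
least P P? {N} pN = search N 0 refl (λ _ ())
  where
  -- upward search from m; invariant: m + t ≡ N and nothing below m satisfies P
  search : ∀ t m → m + t ≡ N → (∀ i → i < m → ¬ P i) →
           Σ ℕ λ j → j ≤ N × P j × (∀ i → i < j → ¬ P i)
  search t m m+t≡N below with P? m
  ... | yes pm = m , subst (m ≤_) m+t≡N (m≤m+n m t) , pm , below
  search zero m m+0≡N below | no ¬pm =
    ⊥-elim (¬pm (subst P (≡.sym (trans (≡.sym (+-identityʳ m)) m+0≡N)) pN))
  search (suc t) m m+t≡N below | no ¬pm = search t (suc m) (trans (≡.sym (+-suc m t)) m+t≡N) below′
    where
    below′ : ∀ i → i < suc m → ¬ P i
    below′ i i<1+m with i ≟ m
    ... | yes refl = ¬pm
    ... | no i≢m = below i (≤∧≢⇒< (s≤s⁻¹ i<1+m) i≢m)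

first-switch : ∀ (f : ℕ → Bool) N → f 0 ≡ true → f N ≡ false →
               Σ ℕ λ k → k < N × f k ≡ true × f (suc k) ≡ false
first-switch f zero f0 fN with trans (≡.sym f0) fN
... | ()
first-switch f (suc N) f0 fN with f N in fN′
... | true = N , ≤-refl , fN′ , fN
... | false with first-switch f N f0 fN′
...   | k , k<N , fk , fk+1 = k , m≤n⇒m≤1+n k<N , fk , fk+1

∸-suc : ∀ {t b} → t < b → b ∸ t ≡ suc (b ∸ suc t)
∸-suc {zero} {suc b} _ = refl
∸-suc {suc t} {suc b} (s≤s t<b) = ∸-suc t<b

split-index : ∀ a b i → i ≤ a + suc b → i ≤ a ⊎ Σ ℕ λ t → t ≤ b × i ≡ suc a + t
split-index a b i i≤ with i ≤? a
... | yes i≤a = inj₁ i≤a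
... | no i≰a = inj₂ (i ∸ suc a , +-cancelˡ-≤ (suc a) _ b (subst₂ _≤_ (≡.sym i≡) (+-suc a b) i≤) , ≡.sym i≡)
  where
  i≡ : suc a + (i ∸ suc a) ≡ i
  i≡ = m+[n∸m]≡n (≰⇒> i≰a)

argmax : ∀ {k} (h : Fin (suc k) → ℕ) → Σ (Fin (suc k)) λ i → ∀ j → h j ≤ h i
argmax {zero} h = fzero , λ { fzero → ≤-refl }
argmax {suc k} h with argmax (h ∘ fsuc)
... | i , max-i with h fzero ≤? h (fsuc i)
...   | yes h0≤ = fsuc i , λ { fzero → h0≤ ; (fsuc j) → max-i j }
...   | no h0≰ = fzero , λ { fzero → ≤-refl ; (fsuc j) → ≤-trans (max-i j) (<⇒≤ (≰⇒> h0≰)) }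

∑ : ∀ {m} → (Fin m → ℕ) → ℕ
∑ f = sum (tabulate f)

∑-positive : ∀ {m} (f : Fin m → ℕ) → 1 ≤ ∑ f → ∃[ i ] 1 ≤ f i
∑-positive {zero} f ()
∑-positive {suc m} f pos with f fzero in f0
... | suc _ = fzero , subst (1 ≤_) (≡.sym f0) (s≤s z≤n)
... | zero with ∑-positive (f ∘ fsuc) pos
...   | i , fi = fsuc i , fi

term≤∑ : ∀ {m} (f : Fin m → ℕ) i → f i ≤ ∑ f
term≤∑ f fzero = m≤m+n _ _
term≤∑ f (fsuc i) = ≤-trans (term≤∑ (f ∘ fsuc) i) (m≤n+m _ _)

two-terms≤∑ : ∀ {m} (f : Fin m → ℕ) i j → i ≢ j → f i + f j ≤ ∑ f
two-terms≤∑ f fzero fzero i≢j = contradiction refl i≢j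
two-terms≤∑ f fzero (fsuc j) _ = +-monoʳ-≤ (f fzero) (term≤∑ (f ∘ fsuc) j)
two-terms≤∑ f (fsuc i) fzero _ =
  subst (_≤ ∑ f) (+-comm (f fzero) (f (fsuc i))) (+-monoʳ-≤ (f fzero) (term≤∑ (f ∘ fsuc) i))
two-terms≤∑ f (fsuc i) (fsuc j) i≢j =
  ≤-trans (two-terms≤∑ (f ∘ fsuc) i j (i≢j ∘ cong fsuc)) (m≤n+m _ _)

∑≥2⇒two-positive : ∀ {m} (f : Fin m → ℕ) → (∀ i → f i ≤ 1) → 2 ≤ ∑ f →
                   Σ (Fin m) λ i → Σ (Fin m) λ j → i ≢ j × 1 ≤ f i × 1 ≤ f j
∑≥2⇒two-positive {zero} f _ ()
∑≥2⇒two-positive {suc m} f ≤1 two with f fzero in f0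
... | zero with ∑≥2⇒two-positive (f ∘ fsuc) (≤1 ∘ fsuc) two
...   | i , j , i≢j , fi , fj = fsuc i , fsuc j , i≢j ∘ FinP.suc-injective , fi , fj
∑≥2⇒two-positive {suc m} f ≤1 two | suc zero with ∑-positive (f ∘ fsuc) (s≤s⁻¹ two)
...   | j , fj = fzero , fsuc j , (λ ()) , subst (1 ≤_) (≡.sym f0) ≤-refl , fj
∑≥2⇒two-positive {suc m} f ≤1 two | suc (suc _) =
  contradiction (subst (_≤ 1) f0 (≤1 fzero)) λ { (s≤s ()) }

module _ {n} (G : Graph n) where

  adj-sym : ∀ {x y} → Adj G x y → Adj G y x
  adj-sym {x} {y} a = trans (sym G y x) a

  adj⇒≢ : ∀ {x y} → Adj G x y → x ≢ y
  adj⇒≢ {x} a refl with trans (≡.sym a) (irrefl G x)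
  ... | ()

  walk-map : ∀ {P Q : VSet n} → (∀ v → P v → Q v) → ∀ {x y k} → WalkIn G P x y k → WalkIn G Q x y k
  walk-map P⊆Q (nil p) = nil (P⊆Q _ p)
  walk-map P⊆Q (cons p a w) = cons (P⊆Q _ p) a (walk-map P⊆Q w)

  walk-forget : ∀ {P : VSet n} {x y k} → WalkIn G P x y k → WalkIn G All x y k
  walk-forget = walk-map (λ _ _ → tt)

  walk-++ : ∀ {P x y z a b} → WalkIn G P x y a → WalkIn G P y z b → WalkIn G P x z (a + b)
  walk-++ (nil _) w = w
  walk-++ (cons p a v) w = cons p a (walk-++ v w)

  walk-snoc : ∀ {P x y z k} → WalkIn G P x y k → Adj G y z → P z → WalkIn G P x z (suc k)
  walk-snoc (nil p) a pz = cons p a (nil pz)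
  walk-snoc (cons p a w) b pz = cons p a (walk-snoc w b pz)

  walk-reverse : ∀ {P x y k} → WalkIn G P x y k → WalkIn G P y x k
  walk-reverse (nil p) = nil p
  walk-reverse (cons p a w) = walk-snoc (walk-reverse w) (adj-sym a) p

  walk-start : ∀ {P x y k} → WalkIn G P x y k → P x
  walk-start (nil p) = p
  walk-start (cons p _ _) = p

  Steps : (ℕ → Fin n) → ℕ → Set
  Steps f L = ∀ i → i < L → Adj G (f i) (f (suc i))

  walk⇒steps : ∀ {P x y L} → WalkIn G P x y L →
    Σ (ℕ → Fin n) λ f → f 0 ≡ x × f L ≡ y × Steps f L × (∀ i → i ≤ L → P (f i))
  walk⇒steps {x = x} (nil p) = (λ _ → x) , refl , refl , (λ _ ()) , (λ _ _ → p)
  walk⇒steps {P} {x = x} (cons {k = k} p a w) with walk⇒steps w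
  ... | g , g0 , gL , g-steps , gP = f , refl , gL , f-steps , fP
    where
    f : ℕ → Fin n
    f zero = x
    f (suc i) = g i
    f-steps : Steps f (suc k)
    f-steps zero _ = subst (Adj G x) (≡.sym g0) a
    f-steps (suc i) (s≤s i<) = g-steps i i<
    fP : ∀ i → i ≤ suc k → P (f i)
    fP zero _ = p
    fP (suc i) (s≤s i≤) = gP i i≤

  steps⇒walk : ∀ {P : VSet n} (f : ℕ → Fin n) {M} → Steps f M → (∀ i → i ≤ M → P (f i)) →
               ∀ a L → a + L ≤ M → WalkIn G P (f a) (f (a + L)) L
  steps⇒walk {P} f f-steps fP a zero a≤M =
    subst (λ z → WalkIn G P (f a) (f z) 0) (≡.sym (+-identityʳ a)) (nil (fP a (≤-trans (m≤m+n a 0) a≤M)))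
  steps⇒walk {P} f {M} f-steps fP a (suc L) a+L<M =
    cons (fP a (≤-trans (m≤m+n a (suc L)) a+L<M)) (f-steps a (<-≤-trans (m<m+n a (s≤s z≤n)) a+L<M))
      (subst (λ z → WalkIn G P (f (suc a)) (f z) L) (≡.sym (+-suc a L))
        (steps⇒walk f f-steps fP (suc a) L (subst (_≤ M) (+-suc a L) a+L<M)))

  steps⇒walk′ : ∀ (f : ℕ → Fin n) {M} → Steps f M → ∀ {a b} → a ≤ b → b ≤ M →
                WalkIn G All (f a) (f b) (b ∸ a)
  steps⇒walk′ f f-steps {a} {b} a≤b b≤M =
    subst (λ z → WalkIn G All (f a) (f z) (b ∸ a)) (m+[n∸m]≡n a≤b)
      (steps⇒walk f f-steps (λ _ _ → tt) a (b ∸ a) (subst (_≤ _) (≡.sym (m+[n∸m]≡n a≤b)) b≤M))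

  dist-unique : ∀ {P x y a b} → DistIn G P x y a → DistIn G P x y b → a ≡ b
  dist-unique (wa , min-a) (wb , min-b) = ≤-antisym (min-a _ wb) (min-b _ wa)

  dist-zero : ∀ {x y} → Dist G x y 0 → x ≡ y
  dist-zero (nil _ , _) = refl

  walk? : ∀ m x y → Dec (WalkIn G All x y m)
  walk? zero x y with x FinP.≟ y
  ... | yes refl = yes (nil tt)
  ... | no x≢y = no λ { (nil _) → x≢y refl }
  walk? (suc m) x y with FinP.any? (λ w → (adj G x w ≟ᵇ true) ×-dec walk? m w y)
  ... | yes (w , a , wk) = yes (cons tt a wk)
  ... | no none = no λ { (cons {w = w} _ a wk) → none (w , a , wk) }

  dist-exists : ∀ {x y k} → WalkIn G All x y k → ∃[ d ] Dist G x y d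
  dist-exists {x} {y} wk with least (λ m → WalkIn G All x y m) (λ m → walk? m x y) wk
  ... | d , _ , wd , shorter = d , wd , minimal
    where
    minimal : ∀ k → WalkIn G All x y k → d ≤ k
    minimal k wk′ with d ≤? k
    ... | yes d≤k = d≤k
    ... | no d≰k = contradiction wk′ (shorter k (≰⇒> d≰k))

  dist-prefix : ∀ {x y L} (f : ℕ → Fin n) → f 0 ≡ x → f L ≡ y → Steps f L → Dist G x y L →
                ∀ i → i ≤ L → Dist G x (f i) i
  dist-prefix {x} {y} {L} f f0 fL f-steps (_ , minimal) i i≤L = head , head-minimal
    where
    head : WalkIn G All x (f i) i
    head = subst (λ z → WalkIn G All z (f i) i) f0 (steps⇒walk′ f f-steps z≤n i≤L)
    tail : WalkIn G All (f i) y (L ∸ i)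
    tail = subst (λ z → WalkIn G All (f i) z (L ∸ i)) fL (steps⇒walk′ f f-steps i≤L ≤-refl)
    head-minimal : ∀ j → WalkIn G All x (f i) j → i ≤ j
    head-minimal j wj = +-cancelʳ-≤ (L ∸ i) i j
      (subst (_≤ j + (L ∸ i)) (≡.sym (m+[n∸m]≡n i≤L)) (minimal _ (walk-++ wj tail)))

  NoBacktrack : (ℕ → Fin n) → ℕ → Set
  NoBacktrack f L = ∀ i → suc (suc i) ≤ L → f i ≢ f (suc (suc i))

  shortest-no-backtrack : ∀ {x y} (f : ℕ → Fin n) L → f 0 ≡ x → f L ≡ y → Steps f L → Dist G x y L →
                          NoBacktrack f L
  shortest-no-backtrack {x} {y} f L f0 fL f-steps (_ , minimal) i i+2≤L fi≡fi+2 =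
    <-irrefl refl (≤-trans (n≤1+n _) (subst (_≤ i + rest) (≡.sym L≡) (minimal _ shortcut)))
    where
    rest : ℕ
    rest = L ∸ suc (suc i)
    L≡ : suc (suc i) + rest ≡ L
    L≡ = m+[n∸m]≡n i+2≤L
    shortcut : WalkIn G All x y (i + rest)
    shortcut = subst₂ (λ a b → WalkIn G All a b (i + rest)) f0 fL
      (walk-++ (steps⇒walk′ f f-steps z≤n (≤-trans (m≤n⇒m≤1+n (n≤1+n i)) i+2≤L))
               (subst (λ z → WalkIn G All z (f L) rest) (≡.sym fi≡fi+2) (steps⇒walk′ f f-steps i+2≤L ≤-refl)))

ecc-bound : ∀ {n} {G : Graph n} {P : VSet n} {w z m e} → EccIn G P w e → P z →
            (∀ ℓ → WalkIn G P w z ℓ → m ≤ ℓ) → m ≤ e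
ecc-bound (far , _) pz long with far _ pz
... | ℓ , ℓ≤e , wk , _ = ≤-trans (long ℓ wk) ℓ≤e

module _ {n} (G : Graph n) where

  closed-walk⇒cycle : ∀ (g : ℕ → Fin n) k → 2 ≤ k → Steps G g k → Adj G (g k) (g 0) →
    (∀ i j → i ≤ k → j ≤ k → g i ≡ g j → i ≡ j) → CycleIn G All k
  closed-walk⇒cycle g k 2≤k g-steps closing injective = record
    { len≥3 = 2≤k
    ; vert = λ i → g (toℕ i)
    ; inj = λ {i} {j} e → FinP.toℕ-injective (injective (toℕ i) (toℕ j) (bound i) (bound j) e)
    ; inP = λ _ → tt
    ; step = λ i → subst (λ z → Adj G (g z) (g (suc (toℕ i)))) (≡.sym (FinP.toℕ-inject₁ i))
                     (g-steps (toℕ i) (FinP.toℕ<n i))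
    ; close = subst (λ z → Adj G (g z) (g 0)) (≡.sym (FinP.toℕ-fromℕ k)) closing
    }
    where
    bound : ∀ (i : Fin (suc k)) → toℕ i ≤ k
    bound i = s≤s⁻¹ (FinP.toℕ<n i)

  TwoNeighbours : ∀ {P k} → CycleIn G P k → Fin (suc k) → Set
  TwoNeighbours {k = k} C i = Σ (Fin (suc k)) λ j₁ → Σ (Fin (suc k)) λ j₂ →
    j₁ ≢ j₂ × Adj G (CycleIn.vert C i) (CycleIn.vert C j₁) × Adj G (CycleIn.vert C i) (CycleIn.vert C j₂)

  cycle-neighbours : ∀ {P k} (C : CycleIn G P k) i → TwoNeighbours C i
  cycle-neighbours {k = zero} C i = contradiction (CycleIn.len≥3 C) λ ()
  cycle-neighbours {k = suc zero} C i = contradiction (CycleIn.len≥3 C) λ { (s≤s ()) }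
  cycle-neighbours {k = suc (suc k)} C i = from-view (view i)
    where
    open CycleIn C
    two-apart : ∀ {m} (j : Fin m) → fsuc (fsuc j) ≢ inject₁ (inject₁ j)
    two-apart fzero ()
    two-apart (fsuc j) e = two-apart j (FinP.suc-injective e)
    from-view : ∀ {i} → View i → TwoNeighbours C i
    from-view ‵fromℕ = fzero , inject₁ (fromℕ (suc k)) , (λ ()) , close , adj-sym G (step (fromℕ (suc k)))
    from-view (‵inj₁ {i = fzero} _) = fsuc fzero , fromℕ (suc (suc k)) , (λ ()) , step fzero , adj-sym G close
    from-view (‵inj₁ {i = fsuc j} _) =
      fsuc (fsuc j) , inject₁ (inject₁ j) , two-apart j , step (fsuc j) , adj-sym G (step (inject₁ j))

  -- The closed sequence running along L 0, …, L a and then back along R (suc b), …, R 1.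
  module Glued (L R : ℕ → Fin n) (a b : ℕ) where
    g : ℕ → Fin n
    g i with i ≤? a
    ... | yes _ = L i
    ... | no _ = R (suc b ∸ (i ∸ suc a))

    g-left : ∀ i → i ≤ a → g i ≡ L i
    g-left i i≤a with i ≤? a
    ... | yes _ = refl
    ... | no i≰a = contradiction i≤a i≰a

    g-right : ∀ t → g (suc a + t) ≡ R (suc b ∸ t)
    g-right t with suc a + t ≤? a
    ... | yes a<a = contradiction (≤-trans (s≤s (m≤m+n a t)) a<a) (<-irrefl refl)
    ... | no _ = cong (λ z → R (suc b ∸ z)) (m+n∸m≡n (suc a) t)

    R-index : ∀ t → t ≤ b → 1 ≤ suc b ∸ t × suc b ∸ t ≤ suc b
    R-index t t≤b = subst (1 ≤_) (≡.sym (∸-suc (s≤s t≤b))) (s≤s z≤n) , m∸n≤m (suc b) t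

  glue-arcs : ∀ (L R : ℕ → Fin n) a b → 1 ≤ a + b →
    Steps G L a → (∀ j → 1 ≤ j → j ≤ b → Adj G (R j) (R (suc j))) →
    Adj G (L a) (R (suc b)) → Adj G (R 1) (L 0) →
    (∀ i i′ → i ≤ a → i′ ≤ a → L i ≡ L i′ → i ≡ i′) →
    (∀ j j′ → 1 ≤ j → j ≤ suc b → 1 ≤ j′ → j′ ≤ suc b → R j ≡ R j′ → j ≡ j′) →
    (∀ i j → i ≤ a → 1 ≤ j → j ≤ suc b → L i ≢ R j) →
    CycleIn G All (a + suc b)
  glue-arcs L R a b 1≤a+b L-steps R-steps L-R R-L L-inj R-inj L≢R =
    closed-walk⇒cycle g (a + suc b) (subst (2 ≤_) (≡.sym (+-suc a b)) (s≤s 1≤a+b)) g-steps closing g-inj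
    where
    open Glued L R a b
    g-steps : Steps G g (a + suc b)
    g-steps i i< with split-index a b i (<⇒≤ i<)
    ... | inj₁ i≤a with i ≟ a
    ...   | yes refl = subst₂ (Adj G) (≡.sym (g-left a ≤-refl))
                         (≡.sym (trans (cong g (≡.sym (+-identityʳ (suc a)))) (g-right 0))) L-R
    ...   | no i≢a = subst₂ (Adj G) (≡.sym (g-left i i≤a)) (≡.sym (g-left (suc i) (≤∧≢⇒< i≤a i≢a)))
                       (L-steps i (≤∧≢⇒< i≤a i≢a))
    g-steps i i< | inj₂ (t , t≤b , refl) =
      subst₂ (Adj G) (≡.sym (g-right t)) (≡.sym (trans (cong g (≡.sym (+-suc (suc a) t))) (g-right (suc t))))
        (subst (λ z → Adj G (R z) (R (suc b ∸ suc t))) (≡.sym (∸-suc (s≤s (≤-trans (n≤1+n t) t+1≤b))))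
          (adj-sym G (R-steps (suc b ∸ suc t) (proj₁ (R-index (suc t) t+1≤b)) (m∸n≤m b t))))
      where
      t+1≤b : suc t ≤ b
      t+1≤b = +-cancelˡ-≤ (suc a) (suc t) b (subst₂ _≤_ (≡.sym (+-suc (suc a) t)) (+-suc a b) i<)
    closing : Adj G (g (a + suc b)) (g 0)
    closing = subst₂ (Adj G)
      (≡.sym (trans (cong g (+-suc a b)) (trans (g-right b) (cong R (m+n∸n≡m 1 b)))))
      (≡.sym (g-left 0 z≤n)) R-L
    g-inj : ∀ i j → i ≤ a + suc b → j ≤ a + suc b → g i ≡ g j → i ≡ j
    g-inj i j i≤ j≤ gi≡gj with split-index a b i i≤ | split-index a b j j≤
    ... | inj₁ i≤a | inj₁ j≤a = L-inj i j i≤a j≤a (trans (≡.sym (g-left i i≤a)) (trans gi≡gj (g-left j j≤a)))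
    ... | inj₁ i≤a | inj₂ (t , t≤b , refl) =
      contradiction (trans (≡.sym (g-left i i≤a)) (trans gi≡gj (g-right t)))
        (L≢R i _ i≤a (proj₁ (R-index t t≤b)) (proj₂ (R-index t t≤b)))
    ... | inj₂ (t , t≤b , refl) | inj₁ j≤a =
      contradiction (trans (≡.sym (g-left j j≤a)) (trans (≡.sym gi≡gj) (g-right t)))
        (L≢R j _ j≤a (proj₁ (R-index t t≤b)) (proj₂ (R-index t t≤b)))
    ... | inj₂ (t , t≤b , refl) | inj₂ (t′ , t′≤b , refl) =
      cong (suc a +_) (∸-cancelˡ-≡ (m≤n⇒m≤1+n t≤b) (m≤n⇒m≤1+n t′≤b)
        (R-inj _ _ (proj₁ (R-index t t≤b)) (proj₂ (R-index t t≤b)) (proj₁ (R-index t′ t′≤b)) (proj₂ (R-index t′ t′≤b))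
          (trans (≡.sym (g-right t)) (trans gi≡gj (g-right t′)))))

module _ {n} (H : Graph n) (c : Fin n) where

  Geodesic : (ℕ → Fin n) → ℕ → Set
  Geodesic p s = Steps H p s × (∀ i → i ≤ s → Dist H c (p i) i)

  geodesic-to : ∀ {x t} → Dist H c x t → Σ (ℕ → Fin n) λ p → Geodesic p t × p t ≡ x
  geodesic-to D with walk⇒steps H (proj₁ D)
  ... | p , p0 , pt , p-steps , _ = p , (p-steps , dist-prefix H p p0 pt p-steps D) , pt

  geodesic-start : ∀ {p s} → Geodesic p s → p 0 ≡ c
  geodesic-start (_ , p-dist) = ≡.sym (dist-zero H (p-dist 0 z≤n))

  extend : (ℕ → Fin n) → ℕ → Fin n → ℕ → Fin n
  extend p t x i with i ≤? t
  ... | yes _ = p i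
  ... | no _ = x

  extend-≤ : ∀ p {t} x {i} → i ≤ t → extend p t x i ≡ p i
  extend-≤ p {t} x {i} i≤t with i ≤? t
  ... | yes _ = refl
  ... | no i≰t = contradiction i≤t i≰t

  extend-end : ∀ p t x → extend p t x (suc t) ≡ x
  extend-end p t x with suc t ≤? t
  ... | yes t<t = contradiction t<t (<-irrefl refl)
  ... | no _ = refl

  extend-geodesic : ∀ {p t x} → Geodesic p t → Dist H c x (suc t) → Adj H (p t) x →
                    Geodesic (extend p t x) (suc t)
  extend-geodesic {p} {t} {x} (p-steps , p-dist) Dx pt~x = steps , dist
    where
    steps : Steps H (extend p t x) (suc t)
    steps i (s≤s i≤t) with i ≟ t
    ... | yes refl = subst₂ (Adj H) (≡.sym (extend-≤ p x ≤-refl)) (≡.sym (extend-end p t x)) pt~x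
    ... | no i≢t = subst₂ (Adj H) (≡.sym (extend-≤ p x i≤t)) (≡.sym (extend-≤ p x (≤∧≢⇒< i≤t i≢t)))
                     (p-steps i (≤∧≢⇒< i≤t i≢t))
    dist : ∀ i → i ≤ suc t → Dist H c (extend p t x i) i
    dist i i≤ with i ≤? t
    ... | yes i≤t = p-dist i i≤t
    ... | no i≰t with ≤-antisym i≤ (≰⇒> i≰t)
    ...   | refl = Dx

  last-agreement : ∀ (p q : ℕ → Fin n) → p 0 ≡ q 0 → ∀ t → p t ≡ q t ⊎
    Σ ℕ λ m → Σ ℕ λ b → m + suc b ≡ t × p m ≡ q m ×
      (∀ j → 1 ≤ j → j ≤ suc b → p (m + j) ≢ q (m + j))
  last-agreement p q p0≡q0 zero = inj₁ p0≡q0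
  last-agreement p q p0≡q0 (suc t) with p (suc t) FinP.≟ q (suc t)
  ... | yes agree = inj₁ agree
  ... | no differ with last-agreement p q p0≡q0 t
  ...   | inj₁ agree = inj₂ (t , 0 , +-comm t 1 , agree , only-last)
    where
    only-last : ∀ j → 1 ≤ j → j ≤ 1 → p (t + j) ≢ q (t + j)
    only-last j 1≤j j≤1 with ≤-antisym j≤1 1≤j
    ... | refl = subst (λ z → p z ≢ q z) (+-comm 1 t) differ
  ...   | inj₂ (m , b , m+b+1≡t , agree , differs) = inj₂ (m , suc b , len , agree , differs′)
    where
    len : m + suc (suc b) ≡ suc t
    len = trans (+-suc m (suc b)) (cong suc m+b+1≡t)
    differs′ : ∀ j → 1 ≤ j → j ≤ suc (suc b) → p (m + j) ≢ q (m + j)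
    differs′ j 1≤j j≤ with j ≟ suc (suc b)
    ... | yes refl = subst (λ z → p z ≢ q z) (≡.sym len) differ
    ... | no j≢ = differs j 1≤j (s≤s⁻¹ (≤∧≢⇒< j≤ j≢))

  geodesic-cycle : ∀ {p q} m b e → Geodesic p (m + suc b + e) → Geodesic q (m + suc b) →
    p m ≡ q m → (∀ j → 1 ≤ j → j ≤ suc b → p (m + j) ≢ q (m + j)) →
    Adj H (p (m + suc b + e)) (q (m + suc b)) → CycleIn H All (suc b + e + suc b)
  geodesic-cycle {p} {q} m b e (p-steps , p-dist) (q-steps , q-dist) agree differ end =
    glue-arcs H L R a b (s≤s z≤n) L-steps R-steps L-R R-L L-inj R-inj L≢R
    where
    a : ℕ
    a = suc b + e
    L R : ℕ → Fin n
    L i = p (m + i)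
    R j = q (m + j)
    m+a : m + a ≡ m + suc b + e
    m+a = ≡.sym (+-assoc m (suc b) e)
    L-dist : ∀ {i} → i ≤ a → Dist H c (L i) (m + i)
    L-dist {i} i≤a = p-dist (m + i) (subst (m + i ≤_) m+a (+-monoʳ-≤ m i≤a))
    R-dist : ∀ {j} → j ≤ suc b → Dist H c (R j) (m + j)
    R-dist j≤ = q-dist _ (+-monoʳ-≤ m j≤)
    L-steps : Steps H L a
    L-steps i i<a = subst (Adj H (L i) ∘ p) (≡.sym (+-suc m i)) (p-steps (m + i) (subst (m + i <_) m+a (+-monoʳ-< m i<a)))
    R-steps : ∀ j → 1 ≤ j → j ≤ b → Adj H (R j) (R (suc j))
    R-steps j _ j≤b = subst (Adj H (R j) ∘ q) (≡.sym (+-suc m j)) (q-steps (m + j) (+-monoʳ-< m (s≤s j≤b)))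
    L-R : Adj H (L a) (R (suc b))
    L-R = subst (λ z → Adj H (p z) (R (suc b))) (≡.sym m+a) end
    R-L : Adj H (R 1) (L 0)
    R-L = subst₂ (Adj H) (cong q (+-comm 1 m)) (trans (≡.sym agree) (cong p (≡.sym (+-identityʳ m))))
            (adj-sym H (q-steps m (m<m+n m (s≤s z≤n))))
    -- on both arcs the index is determined by the distance from c
    L-inj : ∀ i i′ → i ≤ a → i′ ≤ a → L i ≡ L i′ → i ≡ i′
    L-inj i i′ i≤ i′≤ e = +-cancelˡ-≡ m i i′ (dist-unique H (L-dist i≤) (subst (λ z → Dist H c z _) (≡.sym e) (L-dist i′≤)))
    R-inj : ∀ j j′ → 1 ≤ j → j ≤ suc b → 1 ≤ j′ → j′ ≤ suc b → R j ≡ R j′ → j ≡ j′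
    R-inj j j′ _ j≤ _ j′≤ e = +-cancelˡ-≡ m j j′ (dist-unique H (R-dist j≤) (subst (λ z → Dist H c z _) (≡.sym e) (R-dist j′≤)))
    L≢R : ∀ i j → i ≤ a → 1 ≤ j → j ≤ suc b → L i ≢ R j
    L≢R i j i≤ 1≤j j≤ e = differ j 1≤j j≤ (subst (λ z → L z ≡ R j) i≡j e)
      where
      i≡j : i ≡ j
      i≡j = +-cancelˡ-≡ m i j (dist-unique H (L-dist i≤) (subst (λ z → Dist H c z _) (≡.sym e) (R-dist j≤)))

  cycle-length≤ : ∀ m b e → suc b + e + suc b ≤ m + suc b + e + (m + suc b)
  cycle-length≤ m b e = +-mono-≤ (+-monoˡ-≤ e (m≤n+m (suc b) m)) (m≤n+m (suc b) m)

  -- Girth ≥ 2t + 2: no edge joins two vertices at distance t from c, since the geodesics to them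
  -- and the edge would close a cycle of length ≤ 2t + 1.
  no-edge-within-level : ∀ {g x y t} → GirthAtLeast H g → 2 + (t + t) ≤ g →
                         Dist H c x t → Dist H c y t → ¬ Adj H x y
  no-edge-within-level {g} {x} {y} {t} girth long Dx Dy x~y
    with geodesic-to Dx | geodesic-to Dy
  ... | p , gp , pt | q , gq , qt
    with last-agreement p q (trans (geodesic-start gp) (≡.sym (geodesic-start gq))) t
  ... | inj₁ agree = adj⇒≢ H x~y (trans (≡.sym pt) (trans agree qt))
  ... | inj₂ (m , b , refl , agree , differ) =
    contradiction (≤-trans long (≤-trans (girth _ C) (s≤s short))) (<-irrefl refl)
    where
    ℓ : ℕ
    ℓ = m + suc b
    end : Adj H (p (ℓ + 0)) (q ℓ)
    end = subst₂ (Adj H) (≡.sym (trans (cong p (+-identityʳ ℓ)) pt)) (≡.sym qt) x~y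
    C : CycleIn H All (suc b + 0 + suc b)
    C = geodesic-cycle m b 0 (subst (Geodesic p) (≡.sym (+-identityʳ ℓ)) gp) gq agree differ end
    short : suc b + 0 + suc b ≤ ℓ + ℓ
    short = subst (suc b + 0 + suc b ≤_) (cong (_+ ℓ) (+-identityʳ ℓ)) (cycle-length≤ m b 0)

  -- Girth ≥ 2t + 3: a vertex at distance t + 1 from c has a unique neighbour at distance t, since
  -- the geodesics through two such neighbours would close a cycle of length ≤ 2t + 2.
  unique-parent : ∀ {g a b x t} → GirthAtLeast H g → 3 + (t + t) ≤ g →
                  Dist H c a t → Dist H c b t → Dist H c x (suc t) → Adj H a x → Adj H b x → a ≡ b
  unique-parent {g} {a} {b} {x} {t} girth long Da Db Dx a~x b~x
    with geodesic-to Da | geodesic-to Db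
  ... | p , gp , pt | q , gq , qt
    with last-agreement (extend p t x) q
           (trans (extend-≤ p {t} x z≤n) (trans (geodesic-start gp) (≡.sym (geodesic-start gq)))) t
  ... | inj₁ agree = trans (≡.sym pt) (trans (≡.sym (extend-≤ p x ≤-refl)) (trans agree qt))
  ... | inj₂ (m , k , refl , agree , differ) =
    contradiction (≤-trans long (≤-trans (girth _ C) (s≤s short))) (<-irrefl refl)
    where
    ℓ : ℕ
    ℓ = m + suc k
    p′ : ℕ → Fin n
    p′ = extend p ℓ x
    gp′ : Geodesic p′ (ℓ + 1)
    gp′ = subst (Geodesic p′) (+-comm 1 ℓ) (extend-geodesic gp Dx (subst (λ z → Adj H z x) (≡.sym pt) a~x))
    end : Adj H (p′ (ℓ + 1)) (q ℓ)
    end = subst₂ (Adj H) (≡.sym (trans (cong p′ (+-comm ℓ 1)) (extend-end p ℓ x))) (≡.sym qt) (adj-sym H b~x)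
    C : CycleIn H All (suc k + 1 + suc k)
    C = geodesic-cycle m k 1 gp′ gq agree differ end
    short : suc k + 1 + suc k ≤ suc (ℓ + ℓ)
    short = subst (suc k + 1 + suc k ≤_) (cong (_+ ℓ) (+-comm ℓ 1)) (cycle-length≤ m k 1)

module _ {n} (H : Graph n) where

  alive : ℕ → Fin n → Bool
  alive k = iterate k (pruneStep H) (λ _ → true)

  core? : ∀ v → Dec (IsCore H v)
  core? v = alive n v ≟ᵇ true

  Nbr : (Fin n → Bool) → Fin n → Fin n → Set
  Nbr T v w = T w ≡ true × Adj H v w

  indicator : (Fin n → Bool) → Fin n → Fin n → ℕ
  indicator T v w = if T w ∧ adj H v w then 1 else 0

  degIn≡∑ : ∀ T v → degIn H T v ≡ ∑ (indicator T v)
  degIn≡∑ T v = cong sum (map-tabulate (λ w → w) (indicator T v))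

  indicator≤1 : ∀ T v w → indicator T v w ≤ 1
  indicator≤1 T v w with T w ∧ adj H v w
  ... | true = ≤-refl
  ... | false = z≤n

  indicator⇒nbr : ∀ {T v w} → 1 ≤ indicator T v w → Nbr T v w
  indicator⇒nbr {T} {v} {w} pos with T w | adj H v w
  ... | true | true = refl , refl

  nbr⇒indicator : ∀ {T v w} → Nbr T v w → 1 ≤ indicator T v w
  nbr⇒indicator {T} {v} {w} (Tw , v~w) rewrite Tw | v~w = ≤-refl

  deg1-unique : ∀ {T v a b} → degIn H T v ≡ 1 → Nbr T v a → Nbr T v b → a ≡ b
  deg1-unique {T} {v} {a} {b} deg1 na nb with a FinP.≟ b
  ... | yes a≡b = a≡b
  ... | no a≢b = contradiction (≤-trans two (≤-reflexive (trans (≡.sym (degIn≡∑ T v)) deg1))) λ { (s≤s ()) }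
    where
    two : 2 ≤ ∑ (indicator T v)
    two = ≤-trans (+-mono-≤ (nbr⇒indicator {T} {v} na) (nbr⇒indicator {T} {v} nb)) (two-terms≤∑ (indicator T v) a b a≢b)

  deg≢1-another : ∀ {T v a} → degIn H T v ≢ 1 → Nbr T v a → Σ (Fin n) λ b → b ≢ a × Nbr T v b
  deg≢1-another {T} {v} {a} deg≢1 na
    with ∑≥2⇒two-positive (indicator T v) (indicator≤1 T v) (≤∧≢⇒< one (deg≢1 ∘ trans (degIn≡∑ T v) ∘ ≡.sym))
    where
    one : 1 ≤ ∑ (indicator T v)
    one = ≤-trans (nbr⇒indicator {T} {v} na) (term≤∑ (indicator T v) a)
  ... | i , j , i≢j , pi , pj with i FinP.≟ a
  ...   | yes refl = j , i≢j ∘ ≡.sym , indicator⇒nbr {T} {v} pj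
  ...   | no i≢a = i , i≢a , indicator⇒nbr {T} {v} pi

  alive-suc : ∀ {k v} → alive (suc k) v ≡ true → alive k v ≡ true
  alive-suc {k} {v} e with alive k v
  ... | true = refl
  ... | false = e

  alive-mono : ∀ {k k′ v} → k ≤ k′ → alive k′ v ≡ true → alive k v ≡ true
  alive-mono {k′ = zero} z≤n e = e
  alive-mono {k′ = suc k′} k≤ e with m≤n⇒m<n∨m≡n k≤
  ... | inj₁ k<1+k′ = alive-mono (s≤s⁻¹ k<1+k′) (alive-suc {k′} e)
  ... | inj₂ refl = e

  removed⇒deg1 : ∀ {k v} → alive k v ≡ true → alive (suc k) v ≡ false → degIn H (alive k) v ≡ 1
  removed⇒deg1 {k} {v} e e′ = test-false _ (subst (λ b → b ∧ not (degIn H (alive k) v ≡ᵇ 1) ≡ false) e e′)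
    where
    test-false : ∀ m → not (m ≡ᵇ 1) ≡ false → m ≡ 1
    test-false (suc zero) _ = refl

  kept : ∀ {k v} → alive k v ≡ true → degIn H (alive k) v ≢ 1 → alive (suc k) v ≡ true
  kept {k} {v} e deg≢1 = cong₂ _∧_ e (test-true _ deg≢1)
    where
    test-true : ∀ m → m ≢ 1 → not (m ≡ᵇ 1) ≡ true
    test-true zero _ = refl
    test-true (suc zero) m≢1 = contradiction refl m≢1
    test-true (suc (suc _)) _ = refl

  prune-cong : ∀ (S T : Fin n → Bool) → (∀ w → S w ≡ T w) → ∀ v → pruneStep H S v ≡ pruneStep H T v
  prune-cong S T S≗T v = cong₂ (λ b m → b ∧ not (m ≡ᵇ 1)) (S≗T v)
    (cong sum (map-cong (λ w → cong (λ b → if b ∧ adj H v w then 1 else 0) (S≗T w)) (allFin n)))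

  stays-stable : ∀ k → (∀ w → alive (suc k) w ≡ alive k w) → ∀ j w → alive (j + k) w ≡ alive k w
  stays-stable k stable zero w = refl
  stays-stable k stable (suc j) w = trans (prune-cong (alive (j + k)) (alive k) (stays-stable k stable j) w) (stable w)

  Removed : Fin n → ℕ → Set
  Removed v k = alive k v ≡ true × alive (suc k) v ≡ false

  removed-once : ∀ {v k k′} → Removed v k → Removed v k′ → k ≡ k′
  removed-once {v} {k} {k′} (ak , dk) (ak′ , dk′) with <-cmp k k′
  ... | tri< k<k′ _ _ = contradiction (trans (≡.sym dk) (alive-mono k<k′ ak′)) λ ()
  ... | tri≈ _ k≡k′ _ = k≡k′
  ... | tri> _ _ k′<k = contradiction (trans (≡.sym dk′) (alive-mono k′<k ak)) λ ()

  removal-in-every-round : ∀ {v} → alive n v ≡ true → alive (suc n) v ≡ false →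
                           ∀ k → k ≤ n → ∃[ w ] Removed w k
  removal-in-every-round {v} an dn k k≤n
    with FinP.any? (λ w → (alive k w ≟ᵇ true) ×-dec (alive (suc k) w ≟ᵇ false))
  ... | yes found = found
  ... | no none = contradiction false≡true λ ()
    where
    stable : ∀ w → alive (suc k) w ≡ alive k w
    stable w = compare (alive k w) (alive (suc k) w) refl refl
      where
      compare : ∀ a b → alive k w ≡ a → alive (suc k) w ≡ b → alive (suc k) w ≡ alive k w
      compare true true ak ak′ = trans ak′ (≡.sym ak)
      compare false false ak ak′ = trans ak′ (≡.sym ak)
      compare true false ak ak′ = contradiction (w , ak , ak′) none
      compare false true ak ak′ = contradiction (trans (≡.sym ak) (alive-suc {k} ak′)) λ ()
    at : ∀ m → k ≤ m → alive m v ≡ alive k v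
    at m k≤m = subst (λ z → alive z v ≡ alive k v) (m∸n+n≡m k≤m) (stays-stable k stable (m ∸ k) v)
    -- round k changes nothing, so rounds n and n + 1 agree with round k at v
    false≡true : false ≡ true
    false≡true = trans (≡.sym dn) (trans (at (suc n) (m≤n⇒m≤1+n k≤n)) (trans (≡.sym (at n k≤n)) an))

  -- Pruning stabilises within n rounds: distinct rounds remove distinct vertices, so among the
  -- n + 1 rounds 0, …, n some round removes nothing (pigeonhole), and nothing changes afterwards.
  core-stable : ∀ {v} → IsCore H v → alive (suc n) v ≡ true
  core-stable {v} core with alive (suc n) v ≟ᵇ true
  ... | yes alive-v = alive-v
  ... | no dead = contradiction (FinP.injective⇒≤ remover-injective) (<-irrefl refl)
    where
    removal : ∀ (k : Fin (suc n)) → ∃[ w ] Removed w (toℕ k)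
    removal k = removal-in-every-round core (¬-not dead) (toℕ k) (s≤s⁻¹ (FinP.toℕ<n k))
    remover : Fin (suc n) → Fin n
    remover k = proj₁ (removal k)
    remover-injective : Injective _≡_ _≡_ remover
    remover-injective {i} {j} e = FinP.toℕ-injective
      (removed-once (proj₂ (removal i)) (subst (λ w → Removed w (toℕ j)) (≡.sym e) (proj₂ (removal j))))

  core-deg≢1 : ∀ {v} → IsCore H v → degIn H (alive n) v ≢ 1
  core-deg≢1 {v} core deg1 =
    contradiction (trans (≡.sym (core-stable core)) (cong₂ (λ b m → b ∧ not (m ≡ᵇ 1)) core deg1)) λ ()

  core-another : ∀ {v a} → IsCore H v → IsCore H a → Adj H v a →
                 Σ (Fin n) λ b → b ≢ a × IsCore H b × Adj H v b
  core-another cv ca v~a = deg≢1-another (core-deg≢1 cv) (ca , v~a)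

  non-core-removed : ∀ {x} → ¬ IsCore H x → Σ ℕ λ k → k < n × Removed x k
  non-core-removed {x} non-core = first-switch (λ k → alive k x) n refl (¬-not non-core)

  -- Along a non-backtracking walk ending in the core, a vertex alive in round k ≤ n has its
  -- successor alive in round k: a successor removed earlier has degree one at its removal, so its
  -- only alive neighbour is the vertex before it and the vertex after it is already dead, and so on
  -- up to the core end.
  alive-forward : ∀ f L → Steps H f L → NoBacktrack H f L → IsCore H (f L) →
    ∀ {i k} → i < L → k ≤ n → alive k (f i) ≡ true → alive k (f (suc i)) ≡ true
  alive-forward f L steps no-back core {i} i<L = go (L ∸ suc i) i (m+[n∸m]≡n i<L)
    where
    go : ∀ d i → suc i + d ≡ L → ∀ {k} → k ≤ n → alive k (f i) ≡ true → alive k (f (suc i)) ≡ true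
    go zero i i+1≡L k≤n _ =
      alive-mono k≤n (subst (IsCore H ∘ f) (≡.sym (trans (≡.sym (+-identityʳ (suc i))) i+1≡L)) core)
    go (suc d) i i+d+2≡L {k} k≤n fi-alive with alive k (f (suc i)) in e
    ... | true = refl
    ... | false with first-switch (λ j → alive j (f (suc i))) k refl e
    ...   | k′ , k′<k , a′ , d′ = contradiction (deg1-unique {alive k′} (removed⇒deg1 {k′} a′ d′) back fwd) (no-back i i+2≤L)
      where
      L≡ : suc (suc i) + d ≡ L
      L≡ = trans (≡.sym (+-suc (suc i) d)) i+d+2≡L
      i+2≤L : suc (suc i) ≤ L
      i+2≤L = subst (suc (suc i) ≤_) L≡ (m≤m+n (suc (suc i)) d)
      back : Nbr (alive k′) (f (suc i)) (f i)
      back = alive-mono (<⇒≤ k′<k) fi-alive , adj-sym H (steps i (≤-trans (n≤1+n _) i+2≤L))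
      fwd : Nbr (alive k′) (f (suc i)) (f (suc (suc i)))
      fwd = go d (suc i) L≡ (≤-trans (<⇒≤ k′<k) k≤n) a′ , steps (suc i) i+2≤L

  alive-backward : ∀ f L → Steps H f L → NoBacktrack H f L → IsCore H (f 0) →
    ∀ {i k} → i < L → k ≤ n → alive k (f (suc i)) ≡ true → alive k (f i) ≡ true
  alive-backward f L steps no-back core {zero} _ k≤n _ = alive-mono k≤n core
  alive-backward f L steps no-back core {suc i} {k} i+1<L k≤n next-alive with alive k (f (suc i)) in e
  ... | true = refl
  ... | false with first-switch (λ j → alive j (f (suc i))) k refl e
  ...   | k′ , k′<k , a′ , d′ = contradiction (deg1-unique {alive k′} (removed⇒deg1 {k′} a′ d′) back fwd) (no-back i i+1<L)
    where
    i<L : i < L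
    i<L = ≤-trans (n≤1+n _) i+1<L
    back : Nbr (alive k′) (f (suc i)) (f i)
    back = alive-backward f L steps no-back core i<L (≤-trans (<⇒≤ k′<k) k≤n) a′ , adj-sym H (steps i i<L)
    fwd : Nbr (alive k′) (f (suc i)) (f (suc (suc i)))
    fwd = alive-mono (<⇒≤ k′<k) next-alive , steps (suc i) i+1<L

  shortest-walk-in-core : ∀ {x y L} (f : ℕ → Fin n) → f 0 ≡ x → f L ≡ y → Steps H f L → Dist H x y L →
                          IsCore H x → IsCore H y → ∀ j → j ≤ L → IsCore H (f j)
  shortest-walk-in-core f f0 fL steps D cx cy zero _ = subst (IsCore H) (≡.sym f0) cx
  shortest-walk-in-core {L = L} f f0 fL steps D cx cy (suc j) j<L with suc j ≟ L | core? (f (suc j))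
  ... | yes j+1≡L | _ = subst (IsCore H) (≡.sym (trans (cong f j+1≡L) fL)) cy
  ... | no _ | yes core = core
  ... | no j+1≢L | no non-core with non-core-removed non-core
  ...   | k , k<n , alive-k , dead = contradiction (deg1-unique {alive k} (removed⇒deg1 {k} alive-k dead) before after) (no-back j j+2≤L)
    where
    no-back : NoBacktrack H f L
    no-back = shortest-no-backtrack H f L f0 fL steps D
    j+2≤L : suc (suc j) ≤ L
    j+2≤L = ≤∧≢⇒< j<L j+1≢L
    before : Nbr (alive k) (f (suc j)) (f j)
    before = alive-backward f L steps no-back (subst (IsCore H) (≡.sym f0) cx) j<L (<⇒≤ k<n) alive-k ,
             adj-sym H (steps j j<L)
    after : Nbr (alive k) (f (suc j)) (f (suc (suc j)))
    after = alive-forward f L steps no-back (subst (IsCore H) (≡.sym fL) cy) j+2≤L (<⇒≤ k<n) alive-k ,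
            steps (suc j) j+2≤L

  -- For non-core u with link c at distance d, a shortest walk from u to a core vertex w passes
  -- through c: every vertex before it is non-core and is pruned towards the core.
  through-link : ∀ {u c d w D} → IsLink H u c → Dist H u c d → IsCore H w → Dist H u w D →
                 d ≤ D × Dist H c w (D ∸ d)
  through-link {u} {c} {d} {w} {D} (cc , closest) Dc cw Dw
    with walk⇒steps H (proj₁ Dw) | walk⇒steps H (proj₁ Dc)
  ... | f , f0 , fD , f-steps , _ | g , g0 , gd , g-steps , _ = d≤D , walk , minimal
    where
    d≤D : d ≤ D
    d≤D = closest w d D cw Dc Dw
    g-before-c : ∀ i → i < d → ¬ IsCore H (g i)
    g-before-c i i<d cgi = <⇒≱ i<d (closest (g i) d i cgi Dc (dist-prefix H g g0 gd g-steps Dc i (<⇒≤ i<d)))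
    agree : ∀ i → i ≤ d → f i ≡ g i
    agree zero _ = trans f0 (≡.sym g0)
    agree (suc i) i<d with non-core-removed (g-before-c i i<d)
    ... | k , k<n , alive-k , dead = deg1-unique {alive k} (removed⇒deg1 {k} alive-k dead) f-next g-next
      where
      fi≡gi : f i ≡ g i
      fi≡gi = agree i (<⇒≤ i<d)
      i<D : i < D
      i<D = <-≤-trans i<d d≤D
      f-next : Nbr (alive k) (g i) (f (suc i))
      f-next = alive-forward f D f-steps (shortest-no-backtrack H f D f0 fD f-steps Dw)
                 (subst (IsCore H) (≡.sym fD) cw) i<D (<⇒≤ k<n) (subst (λ z → alive k z ≡ true) (≡.sym fi≡gi) alive-k) ,
               subst (λ z → Adj H z (f (suc i))) fi≡gi (f-steps i i<D)
      g-next : Nbr (alive k) (g i) (g (suc i))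
      g-next = alive-forward g d g-steps (shortest-no-backtrack H g d g0 gd g-steps Dc)
                 (subst (IsCore H) (≡.sym gd) cc) i<d (<⇒≤ k<n) alive-k ,
               g-steps i i<d
    walk : WalkIn H All c w (D ∸ d)
    walk = subst₂ (λ a b → WalkIn H All a b (D ∸ d)) (trans (agree d ≤-refl) gd) fD (steps⇒walk′ H f f-steps d≤D ≤-refl)
    minimal : ∀ k → WalkIn H All c w k → D ∸ d ≤ k
    minimal k wk = m≤n+o⇒m∸n≤o D d (proj₂ Dw _ (walk-++ H (proj₁ Dc) wk))

  -- Cycle vertices are never pruned: each keeps its two cycle neighbours.
  cycle-alive : ∀ {P k} (C : CycleIn H P k) → ∀ j i → alive j (CycleIn.vert C i) ≡ true
  cycle-alive C zero i = refl
  cycle-alive C (suc j) i with cycle-neighbours H C i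
  ... | j₁ , j₂ , j₁≢j₂ , a₁ , a₂ = kept {j} (cycle-alive C j i)
        λ deg1 → j₁≢j₂ (CycleIn.inj C (deg1-unique {alive j} deg1 (cycle-alive C j j₁ , a₁) (cycle-alive C j j₂ , a₂)))

  -- In a connected graph that is not a tree every core vertex has a core neighbour:
  -- otherwise it would be the only core vertex, while every cycle lies in the core.
  core-neighbour : ∀ {c} → Connected H → ¬ IsTree H → IsCore H c → Σ (Fin n) λ a → IsCore H a × Adj H c a
  core-neighbour {c} conn not-tree cc with FinP.any? (λ a → core? a ×-dec (adj H c a ≟ᵇ true))
  ... | yes found = found
  ... | no none = contradiction ((c , tt) , conn , acyclic) not-tree
    where
    only-c : ∀ c′ → IsCore H c′ → c′ ≡ c
    only-c c′ cc′ with c′ FinP.≟ c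
    ... | yes c′≡c = c′≡c
    ... | no c′≢c with dist-exists H (proj₂ (conn c c′ tt tt))
    ...   | L , D with walk⇒steps H (proj₁ D)
    ...     | f , f0 , fL , steps , _ with L
    ...       | zero = contradiction (≡.sym (dist-zero H D)) c′≢c
    ...       | suc _ = contradiction (f 1 , shortest-walk-in-core f f0 fL steps D cc cc′ 1 (s≤s z≤n) ,
                                       subst (λ z → Adj H z (f 1)) f0 (steps 0 (s≤s z≤n))) none
    acyclic : AcyclicIn H All
    acyclic k C with cycle-neighbours H C fzero
    ... | j₁ , j₂ , j₁≢j₂ , _ , _ =
      j₁≢j₂ (CycleIn.inj C (trans (only-c _ (cycle-alive C n j₁)) (≡.sym (only-c _ (cycle-alive C n j₂)))))

  core-neighbour-avoiding : ∀ {c} → Connected H → ¬ IsTree H → IsCore H c → ∀ v →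
                            Σ (Fin n) λ a → IsCore H a × Adj H c a × a ≢ v
  core-neighbour-avoiding conn not-tree cc v with core-neighbour conn not-tree cc
  ... | a₁ , ca₁ , c~a₁ with a₁ FinP.≟ v
  ...   | no a₁≢v = a₁ , ca₁ , c~a₁ , a₁≢v
  ...   | yes refl with core-another cc ca₁ c~a₁
  ...     | a₂ , a₂≢a₁ , ca₂ , c~a₂ = a₂ , ca₂ , c~a₂ , a₂≢a₁

module Levels {n} (H : Graph n) (r : ℕ) (conn : Connected H) (girth : GirthAtLeast H (2 * r + 3))
              (c : Fin n) where

  abstract
    δ : Fin n → ℕ
    δ w = proj₁ (dist-exists H (proj₂ (conn c w tt tt)))

    δ-dist : ∀ w → Dist H c w (δ w)
    δ-dist w = proj₂ (dist-exists H (proj₂ (conn c w tt tt)))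

  δ-unique : ∀ {w e} → Dist H c w e → δ w ≡ e
  δ-unique = dist-unique H (δ-dist _)

  δ-c : δ c ≡ 0
  δ-c = δ-unique (nil tt , λ _ _ → z≤n)

  δ≡0 : ∀ {w} → δ w ≡ 0 → w ≡ c
  δ≡0 {w} e = ≡.sym (dist-zero H (subst (Dist H c w) e (δ-dist w)))

  δ≢0 : ∀ {w} → w ≢ c → 1 ≤ δ w
  δ≢0 w≢c = n≢0⇒n>0 (w≢c ∘ δ≡0)

  δ-adj : ∀ {x y} → Adj H x y → δ y ≤ suc (δ x)
  δ-adj {x} {y} x~y = proj₂ (δ-dist y) _ (walk-snoc H (proj₁ (δ-dist x)) x~y tt)

  adj-c : ∀ {x} → Adj H x c → δ x ≡ 1
  adj-c {x} x~c = ≤-antisym (subst (λ z → δ x ≤ suc z) δ-c (δ-adj (adj-sym H x~c))) (δ≢0 (adj⇒≢ H x~c))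

  -- Within level r, adjacent vertices lie on consecutive levels (no edge within a level).
  adjacent-levels : ∀ {x y} → Adj H x y → δ x ≤ r → δ y ≡ suc (δ x) ⊎ δ x ≡ suc (δ y)
  adjacent-levels {x} {y} x~y δx≤r with <-cmp (δ x) (δ y)
  ... | tri< lt _ _ = inj₁ (≤-antisym (δ-adj x~y) lt)
  ... | tri> _ _ gt = inj₂ (≤-antisym (δ-adj (adj-sym H x~y)) gt)
  ... | tri≈ _ same _ = ⊥-elim (no-edge-within-level H c girth long (δ-dist x) (subst (Dist H c y) (≡.sym same) (δ-dist y)) x~y)
    where
    long : 2 + (δ x + δ x) ≤ 2 * r + 3
    long = subst (2 + (δ x + δ x) ≤_) (+-comm 3 (2 * r))
             (s≤s (s≤s (≤-trans (+-mono-≤ δx≤r (subst (δ x ≤_) (≡.sym (+-identityʳ r)) δx≤r)) (n≤1+n _))))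

  parent-unique : ∀ {a b x} → Adj H a x → Adj H b x → δ a ≡ δ b → δ x ≡ suc (δ a) → δ a ≤ r → a ≡ b
  parent-unique {a} {b} {x} a~x b~x same δx δa≤r =
    unique-parent H c girth long (δ-dist a) (subst (Dist H c b) (≡.sym same) (δ-dist b))
      (subst (Dist H c x) δx (δ-dist x)) a~x b~x
    where
    long : 3 + (δ a + δ a) ≤ 2 * r + 3
    long = subst (3 + (δ a + δ a) ≤_) (+-comm 3 (2 * r))
             (s≤s (s≤s (s≤s (+-mono-≤ δa≤r (subst (δ a ≤_) (≡.sym (+-identityʳ r)) δa≤r)))))

  geodesics-agree : ∀ {p q t} → Geodesic H c p t → Geodesic H c q t → p t ≡ q t → t ≤ suc r →
                    ∀ i → i ≤ t → p i ≡ q i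
  geodesics-agree {p} {q} {t} (p-steps , p-dist) (q-steps , q-dist) same-end t≤r+1 i i≤t =
    downward (t ∸ i) i (m∸n+n≡m i≤t)
    where
    downward : ∀ e i → e + i ≡ t → p i ≡ q i
    downward zero i i≡t = subst (λ z → p z ≡ q z) (≡.sym i≡t) same-end
    downward (suc e) i e+i+1≡t = parent-unique (p-steps i i<t)
      (subst (Adj H (q i)) (≡.sym (downward e (suc i) (trans (+-suc e i) e+i+1≡t))) (q-steps i i<t))
      (trans (δ-unique (p-dist i (<⇒≤ i<t))) (≡.sym (δ-unique (q-dist i (<⇒≤ i<t)))))
      (trans (δ-unique (p-dist (suc i) i<t)) (cong suc (≡.sym (δ-unique (p-dist i (<⇒≤ i<t))))))
      (subst (_≤ r) (≡.sym (δ-unique (p-dist i (<⇒≤ i<t)))) (s≤s⁻¹ (≤-trans i<t t≤r+1)))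
      where
      i<t : i < t
      i<t = subst (suc i ≤_) e+i+1≡t (s≤s (m≤n+m i e))

  module GeodesicTo (x : Fin n) where
    p : ℕ → Fin n
    p = proj₁ (geodesic-to H c (δ-dist x))
    gp : Geodesic H c p (δ x)
    gp = proj₁ (proj₂ (geodesic-to H c (δ-dist x)))
    px≡x : p (δ x) ≡ x
    px≡x = proj₂ (proj₂ (geodesic-to H c (δ-dist x)))

  branch : Fin n → Fin n
  branch x = GeodesicTo.p x 1

  -- By uniqueness of geodesics, every geodesic to x of length ≤ r + 1 passes through branch x;
  -- hence moving one level up along an edge keeps the branch, and a level-1 vertex is its own branch.
  branch-geodesic : ∀ {x q t} → Geodesic H c q t → q t ≡ x → 1 ≤ t → t ≤ suc r → q 1 ≡ branch x
  branch-geodesic {x} {q} {t} gq qt≡x 1≤t t≤r+1 = ≡.sym (geodesics-agree gp′ gq (trans px′≡x (≡.sym qt≡x)) t≤r+1 1 1≤t)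
    where
    open GeodesicTo x
    δx≡t : δ x ≡ t
    δx≡t = δ-unique (subst (λ z → Dist H c z t) qt≡x (proj₂ gq t ≤-refl))
    gp′ : Geodesic H c p t
    gp′ = subst (Geodesic H c p) δx≡t gp
    px′≡x : p t ≡ x
    px′≡x = subst (λ z → p z ≡ x) δx≡t px≡x

  branch-step : ∀ {x y} → Adj H x y → δ y ≡ suc (δ x) → 1 ≤ δ x → δ y ≤ suc r → branch y ≡ branch x
  branch-step {x} {y} x~y δy 1≤δx δy≤r+1 = ≡.sym (trans (≡.sym (extend-≤ H c p y 1≤δx))
    (branch-geodesic (extend-geodesic H c gp (subst (Dist H c y) δy (δ-dist y)) (subst (λ z → Adj H z y) (≡.sym px≡x) x~y))
      (extend-end H c p (δ x) y) (s≤s z≤n) (subst (_≤ suc r) δy δy≤r+1)))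
    where
    open GeodesicTo x

  branch-level1 : ∀ {x} → δ x ≡ 1 → branch x ≡ x
  branch-level1 {x} δx≡1 = subst (λ z → p z ≡ x) δx≡1 px≡x
    where
    open GeodesicTo x

  branch-adjacent : ∀ {x y} → Adj H x y → x ≢ c → y ≢ c → δ x ≤ r → δ y ≤ r → branch y ≡ branch x
  branch-adjacent {x} {y} x~y x≢c y≢c δx≤r δy≤r with adjacent-levels x~y δx≤r
  ... | inj₁ up = branch-step x~y up (δ≢0 x≢c) (m≤n⇒m≤1+n δy≤r)
  ... | inj₂ down = ≡.sym (branch-step (adj-sym H x~y) down (δ≢0 y≢c) (m≤n⇒m≤1+n δx≤r))

  walk-through-c : ∀ {P : VSet n} → (∀ w → P w → δ w ≤ r) → ∀ {x z ℓ} → WalkIn H P x z ℓ → z ≢ c →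
                   x ≡ c ⊎ (x ≢ c × branch x ≢ branch z) → δ x + δ z ≤ ℓ
  walk-through-c low wk z≢c (inj₁ refl) = subst (λ a → a + δ _ ≤ _) (≡.sym δ-c) (proj₂ (δ-dist _) _ (walk-forget H wk))
  walk-through-c low (nil _) z≢c (inj₂ (_ , different)) = contradiction refl different
  walk-through-c low {x} {z} (cons {w = y} {k = ℓ} px x~y wk) z≢c (inj₂ (x≢c , different)) with y FinP.≟ c
  ... | yes refl = subst (λ a → a + δ z ≤ suc ℓ) (≡.sym (adj-c x~y)) (s≤s (proj₂ (δ-dist z) ℓ (walk-forget H wk)))
  ... | no y≢c = ≤-trans (+-monoˡ-≤ (δ z) (δ-adj (adj-sym H x~y)))
                   (s≤s (walk-through-c low wk z≢c (inj₂ (y≢c , λ e → different (trans (≡.sym same) e)))))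
    where
    same : branch y ≡ branch x
    same = branch-adjacent x~y x≢c y≢c (low x px) (low y (walk-start H wk))

  -- A core vertex on a level 1 ≤ δ x ≤ r has a core neighbour on the next level: its parent on
  -- the geodesic from c is core, and a second core neighbour can be neither on the level of x
  -- nor another parent.
  core-child : ∀ {x} → IsCore H c → IsCore H x → 1 ≤ δ x → δ x ≤ r →
               Σ (Fin n) λ y → IsCore H y × Adj H x y × δ y ≡ suc (δ x)
  core-child {x} cc cx 1≤δx δx≤r = child (δ x ∸ 1) (m+[n∸m]≡n 1≤δx)
    where
    open GeodesicTo x
    child : ∀ t → suc t ≡ δ x → Σ (Fin n) λ y → IsCore H y × Adj H x y × δ y ≡ suc (δ x)
    child t t+1≡δx = from-another (core-another H cx parent-core (adj-sym H parent~x))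
      where
      t≤δx : t ≤ δ x
      t≤δx = subst (t ≤_) t+1≡δx (n≤1+n t)
      parent~x : Adj H (p t) x
      parent~x = subst (Adj H (p t)) (trans (cong p t+1≡δx) px≡x) (proj₁ gp t (subst (t <_) t+1≡δx ≤-refl))
      parent-core : IsCore H (p t)
      parent-core = shortest-walk-in-core H p (geodesic-start H c gp) px≡x (proj₁ gp) (δ-dist x) cc cx t t≤δx
      δ-parent : δ (p t) ≡ t
      δ-parent = δ-unique (proj₂ gp t t≤δx)
      from-another : (Σ (Fin n) λ b → b ≢ p t × IsCore H b × Adj H x b) →
                     Σ (Fin n) λ y → IsCore H y × Adj H x y × δ y ≡ suc (δ x)
      from-another (y , y≢parent , cy , x~y) with adjacent-levels x~y δx≤r
      ... | inj₁ up = y , cy , x~y , up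
      ... | inj₂ down = contradiction (parent-unique (adj-sym H x~y) parent~x same-level down δy≤r) y≢parent
        where
        same-level : δ y ≡ δ (p t)
        same-level = trans (suc-injective (trans (≡.sym down) (≡.sym t+1≡δx))) (≡.sym δ-parent)
        δy≤r : δ y ≤ r
        δy≤r = ≤-trans (n≤1+n (δ y)) (subst (_≤ r) down δx≤r)

  deep-descendant : IsCore H c → ∀ {b} → IsCore H b → Adj H c b → ∀ t → t < r →
                    Σ (Fin n) λ z → IsCore H z × δ z ≡ suc t × branch z ≡ b
  deep-descendant cc {b} cb c~b zero _ = b , cb , adj-c (adj-sym H c~b) , branch-level1 (adj-c (adj-sym H c~b))
  deep-descendant cc {b} cb c~b (suc t) t+1<r = next (deep-descendant cc cb c~b t (≤-trans (n≤1+n _) t+1<r))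
    where
    next : (Σ (Fin n) λ z → IsCore H z × δ z ≡ suc t × branch z ≡ b) →
           Σ (Fin n) λ y → IsCore H y × δ y ≡ suc (suc t) × branch y ≡ b
    next (z , cz , δz , bz) = grow (core-child cc cz 1≤δz (subst (_≤ r) (≡.sym δz) (<⇒≤ t+1<r)))
      where
      1≤δz : 1 ≤ δ z
      1≤δz = subst (1 ≤_) (≡.sym δz) (s≤s z≤n)
      grow : (Σ (Fin n) λ y → IsCore H y × Adj H z y × δ y ≡ suc (δ z)) →
             Σ (Fin n) λ y → IsCore H y × δ y ≡ suc (suc t) × branch y ≡ b
      grow (y , cy , z~y , δy) = y , cy , δy′ , trans (branch-step z~y δy 1≤δz δy≤r+1) bz
        where
        δy′ : δ y ≡ suc (suc t)
        δy′ = trans δy (cong suc δz)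
        δy≤r+1 : δ y ≤ suc r
        δy≤r+1 = subst (_≤ suc r) (≡.sym δy′) (s≤s (<⇒≤ t+1<r))

  deep-in-other-branch : IsCore H c → ¬ IsTree H → ∀ t → t < r → ∀ v →
                         Σ (Fin n) λ z → IsCore H z × δ z ≡ suc t × branch z ≢ v
  deep-in-other-branch cc not-tree t t<r v with core-neighbour-avoiding H conn not-tree cc v
  ... | a , ca , c~a , a≢v with deep-descendant cc ca c~a t t<r
  ...   | z , cz , δz , bz = z , cz , δz , a≢v ∘ trans (≡.sym bz)

module _ {n} (H : Graph n) (r : ℕ) {u c d} (non-core : ¬ IsCore H u) (link : IsLink H u c)
         (Dc : Dist H u c d) where

  link-in-ball : d ≤ r → InB H r u c × IsCore H c
  link-in-ball d≤r = inj₂ ((λ u≡c → non-core (subst (IsCore H) (≡.sym u≡c) (proj₁ link))) , d , d≤r , Dc) , proj₁ link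

  ball-distance : ∀ {w} → InB H r u w → IsCore H w → Σ ℕ λ D → D ≤ r × Dist H u w D
  ball-distance (inj₁ refl) cu = contradiction cu non-core
  ball-distance (inj₂ (_ , D , D≤r , Dw)) _ = D , D≤r , Dw

  ball-nonempty⇒d≤r : ∀ {w} → InB H r u w → IsCore H w → d ≤ r
  ball-nonempty⇒d≤r inB cw with ball-distance inB cw
  ... | D , D≤r , Dw = ≤-trans (proj₁ (through-link H link Dc cw Dw)) D≤r

module Ball {n} (H : Graph n) (r : ℕ) (conn : Connected H) (girth : GirthAtLeast H (2 * r + 3))
            (not-tree : ¬ IsTree H) {u c d} (non-core : ¬ IsCore H u) (link : IsLink H u c)
            (Dc : Dist H u c d) (d≤r : d ≤ r) where

  open Levels H r conn girth c

  ρ : ℕ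
  ρ = r ∸ d

  Ball : VSet n
  Ball w = InB H r u w × IsCore H w

  cc : IsCore H c
  cc = proj₁ link

  -- By through-link, a core vertex w is in B_u iff δ w ≤ ρ (then dist(u, w) = d + δ w ≤ r).
  in-ball : ∀ {w} → IsCore H w → δ w ≤ ρ → Ball w
  in-ball {w} cw δw≤ρ with dist-exists H (proj₂ (conn u w tt tt))
  ... | D , Dw with through-link H link Dc cw Dw
  ...   | d≤D , Dcw = inj₂ (u≢w , D , D≤r , Dw) , cw
    where
    u≢w : u ≢ w
    u≢w u≡w = non-core (subst (IsCore H) (≡.sym u≡w) cw)
    D≤r : D ≤ r
    D≤r = subst₂ _≤_ (m+[n∸m]≡n d≤D) (m+[n∸m]≡n d≤r) (+-monoʳ-≤ d (subst (_≤ ρ) (δ-unique Dcw) δw≤ρ))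

  ball-level : ∀ {w} → Ball w → δ w ≤ ρ
  ball-level (inB , cw) with ball-distance H r non-core link Dc inB cw
  ... | D , D≤r , Dw = subst (_≤ ρ) (≡.sym (δ-unique (proj₂ (through-link H link Dc cw Dw)))) (∸-monoˡ-≤ d D≤r)

  -- ball vertices lie below level r, where the girth consequences apply
  ball-low : ∀ w → Ball w → δ w ≤ r
  ball-low w bw = ≤-trans (ball-level bw) (m∸n≤m r d)

  c-in-ball : Ball c
  c-in-ball = link-in-ball H r non-core link Dc d≤r

  ball-dist : ∀ {w} → Ball w → DistIn H Ball c w (δ w)
  ball-dist {w} bw = walk , λ k wk → proj₂ (δ-dist w) k (walk-forget H wk)
    where
    open GeodesicTo w
    on-geodesic : ∀ i → i ≤ δ w → Ball (p i)
    on-geodesic i i≤ = in-ball (shortest-walk-in-core H p (geodesic-start H c gp) px≡x (proj₁ gp) (δ-dist w) cc (proj₂ bw) i i≤)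
                               (≤-trans (≤-reflexive (δ-unique (proj₂ gp i i≤))) (≤-trans i≤ (ball-level bw)))
    walk : WalkIn H Ball c w (δ w)
    walk = subst₂ (λ a b → WalkIn H Ball a b (δ w)) (geodesic-start H c gp) px≡x
             (steps⇒walk H p (proj₁ gp) on-geodesic 0 (δ w) ≤-refl)

  ball-connected : ConnectedIn H Ball
  ball-connected v w bv bw = _ , walk-++ H (walk-reverse H (proj₁ (ball-dist bv))) (proj₁ (ball-dist bw))

  -- On a cycle in the ball, a vertex x of maximal level would have two parents.
  ball-acyclic : AcyclicIn H Ball
  ball-acyclic k C with argmax (δ ∘ CycleIn.vert C)
  ... | m , top with cycle-neighbours H C m
  ...   | j₁ , j₂ , j₁≢j₂ , x~a , x~b = j₁≢j₂ (inj (parent-unique (adj-sym H x~a) (adj-sym H x~b) same δx≡ δa≤r))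
    where
    open CycleIn C
    x : Fin n
    x = vert m
    child-of : ∀ {y} → Adj H x y → δ y ≤ δ x → δ x ≡ suc (δ y)
    child-of x~y δy≤δx with adjacent-levels x~y (ball-low x (inP m))
    ... | inj₁ up = contradiction (subst (_≤ δ x) up δy≤δx) (<-irrefl refl)
    ... | inj₂ down = down
    δx≡ : δ x ≡ suc (δ (vert j₁))
    δx≡ = child-of x~a (top j₁)
    same : δ (vert j₁) ≡ δ (vert j₂)
    same = suc-injective (trans (≡.sym δx≡) (child-of x~b (top j₂)))
    δa≤r : δ (vert j₁) ≤ r
    δa≤r = ≤-trans (n≤1+n _) (subst (_≤ r) δx≡ (ball-low x (inP m)))

  ball-tree : IsTreeIn H Ball
  ball-tree = (c , c-in-ball) , ball-connected , ball-acyclic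

  -- A ball vertex v with δ v < ρ has, besides any ball neighbour, a second core neighbour,
  -- which is again in the ball; so leaves lie at depth ρ.
  leaf-dist : ∀ {v} → IsLeafIn H Ball v → DistIn H Ball c v ρ
  leaf-dist {v} (bv , (w , bw , v~w) , one-nbr) with δ v ≟ ρ
  ... | yes δv≡ρ = subst (DistIn H Ball c v) δv≡ρ (ball-dist bv)
  ... | no δv≢ρ with core-another H (proj₂ bv) (proj₂ bw) v~w
  ...   | b , b≢w , cb , v~b = contradiction (one-nbr w b bw bb v~w v~b) (b≢w ∘ ≡.sym)
    where
    bb : Ball b
    bb = in-ball cb (≤-trans (δ-adj v~b) (≤∧≢⇒< (ball-level bv) δv≢ρ))

  deep-ball-vertex : 1 ≤ ρ → ∀ v → Σ (Fin n) λ z → Ball z × δ z ≡ ρ × branch z ≢ v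
  deep-ball-vertex 1≤ρ v with deep-in-other-branch cc not-tree (ρ ∸ 1) ρ-1<r v
    where
    ρ-1<r : ρ ∸ 1 < r
    ρ-1<r = subst (_≤ r) (≡.sym (m+[n∸m]≡n 1≤ρ)) (m∸n≤m r d)
  ... | z , cz , δz , other = z , in-ball cz (≤-reflexive δz≡ρ) , δz≡ρ , other
    where
    δz≡ρ : δ z ≡ ρ
    δz≡ρ = trans δz (m+[n∸m]≡n 1≤ρ)

  far-vertex : Σ (Fin n) λ z → Ball z × δ z ≡ ρ
  far-vertex = at-depth ρ refl
    where
    at-depth : ∀ t → t ≡ ρ → Σ (Fin n) λ z → Ball z × δ z ≡ ρ
    at-depth zero 0≡ρ = c , c-in-ball , trans δ-c 0≡ρ
    at-depth (suc t) t+1≡ρ = let (z , bz , δz≡ρ , _) = deep-ball-vertex (subst (1 ≤_) t+1≡ρ (s≤s z≤n)) c in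
      z , bz , δz≡ρ

  ecc-c : EccIn H Ball c ρ
  ecc-c = (λ w bw → δ w , ball-level bw , ball-dist bw) , farthest
    where
    farthest : ∃[ z ] (Ball z × DistIn H Ball c z ρ)
    farthest = let (z , bz , δz≡ρ) = far-vertex in z , bz , subst (DistIn H Ball c z) δz≡ρ (ball-dist bz)

  -- Every other ball vertex v has eccentricity > ρ: the walk to a deep vertex in another branch
  -- passes through c.
  ecc-other : ∀ {v e} → Ball v → v ≢ c → EccIn H Ball v e → suc ρ ≤ e
  ecc-other {v} {e} bv v≢c ecc = via (deep-ball-vertex 1≤ρ (branch v))
    where
    1≤ρ : 1 ≤ ρ
    1≤ρ = ≤-trans (δ≢0 v≢c) (ball-level bv)
    via : (Σ (Fin n) λ z → Ball z × δ z ≡ ρ × branch z ≢ branch v) → suc ρ ≤ e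
    via (z , bz , δz≡ρ , other) = ecc-bound ecc bz long
      where
      z≢c : z ≢ c
      z≢c z≡c = contradiction (subst (1 ≤_) (trans (≡.sym δz≡ρ) (trans (cong δ z≡c) δ-c)) 1≤ρ) λ ()
      long : ∀ ℓ → WalkIn H Ball v z ℓ → suc ρ ≤ ℓ
      long ℓ wk = ≤-trans (+-mono-≤ (δ≢0 v≢c) (≤-reflexive (≡.sym δz≡ρ)))
                    (walk-through-c ball-low wk z≢c (inj₂ (v≢c , other ∘ ≡.sym)))

  ecc≥ρ : ∀ w e → Ball w → EccIn H Ball w e → ρ ≤ e
  ecc≥ρ w e bw ecc with w FinP.≟ c
  ... | no w≢c = ≤-trans (n≤1+n ρ) (ecc-other bw w≢c ecc)
  ... | yes refl = let (z , bz , δz≡ρ) = far-vertex in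
    ecc-bound ecc bz λ ℓ wk → subst (_≤ ℓ) δz≡ρ (proj₂ (δ-dist z) ℓ (walk-forget H wk))

  ball-centre : UniqueCenterIn H Ball c
  ball-centre = (c-in-ball , ρ , ecc-c , ecc≥ρ) , only-c
    where
    only-c : ∀ v → IsCenterIn H Ball v → v ≡ c
    only-c v (bv , e , ecc , minimal) with v FinP.≟ c
    ... | yes v≡c = v≡c
    ... | no v≢c = contradiction (≤-trans (ecc-other bv v≢c ecc) (minimal c ρ c-in-ball ecc-c)) (<-irrefl refl)

lemma4 : ∀ {n} (H : Graph n) (r : ℕ) → 1 ≤ r → Connected H →
    GirthAtLeast H (2 * r + 3) → ¬ IsTree H →
    ∀ (u c : Fin n) (d : ℕ) → ¬ IsCore H u → IsLink H u c → Dist H u c d →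
      ((∀ w → InB H r u w → ¬ IsCore H w) → r < d) ×
      ((∃[ w ] (InB H r u w × IsCore H w)) →
        IsTreeIn H (λ w → InB H r u w × IsCore H w) ×
        UniqueCenterIn H (λ w → InB H r u w × IsCore H w) c ×
        (∀ v → IsLeafIn H (λ w → InB H r u w × IsCore H w) v →
          DistIn H (λ w → InB H r u w × IsCore H w) c v (r ∸ d)))
lemma4 H r _ conn girth not-tree u c d non-core link Dc = empty-ball , nonempty-ball
  where
  -- if B_u has no core vertex, then c ∉ B_u, so d > r
  empty-ball : (∀ w → InB H r u w → ¬ IsCore H w) → r < d
  empty-ball none = ≰⇒> λ d≤r → let (c∈B , cc) = link-in-ball H r non-core link Dc d≤r in none c c∈B cc
  nonempty-ball : ∃[ w ] (InB H r u w × IsCore H w) →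
    IsTreeIn H (λ w → InB H r u w × IsCore H w) ×
    UniqueCenterIn H (λ w → InB H r u w × IsCore H w) c ×
    (∀ v → IsLeafIn H (λ w → InB H r u w × IsCore H w) v →
      DistIn H (λ w → InB H r u w × IsCore H w) c v (r ∸ d))
  nonempty-ball (w , w∈B , cw) = ball-tree , ball-centre , λ v → leaf-dist
    where open Ball H r conn girth not-tree non-core link Dc (ball-nonempty⇒d≤r H r non-core link Dc w∈B cw)
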